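{- Let $r\geq 2$ and let $(P,\mathcal{L})$ be an $r$-uniform linear system with $\nu_2(P,\mathcal{L})=4$ and $\Delta(P,\mathcal{L})=4$. Then $$\tau(P,\mathcal{L})\leq \frac{|P|+|\mathcal{L}|}{r+1}.$$
   Context: A linear system is a pair $(P,\mathcal{L})$ where $P$ is a finite set (points) and $\mathcal{L}$ is a family of subsets of $P$ (lines) such that $|l\cap l'|\leq 1$ for all distinct $l,l'\in\mathcal{L}$; it is $r$-uniform if every line has exactly $r$ points. The degree of a point is the number of lines containing it, and $\Delta(P,\mathcal{L})$ is the maximum degree. A transversal is a set $T\subseteq P$ meeting every line; $\tau(P,\mathcal{L})$ is the minimum size of a transversal. A 2-packing is a set $R\subseteq\mathcal{L}$ such that no three lines of $R$ have a common point; $\nu_2(P,\mathcal{L})$ is the maximum size of a 2-packing. -}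

module Defs where

open import Data.Nat using (ℕ; _≤_)
open import Data.Fin using (Fin)
open import Data.Fin.Subset using (Subset; _∈_; _∩_; ∣_∣; Nonempty)
open import Data.Vec using (tabulate; lookup)
open import Data.Product using (Σ; _×_; ∃)
open import Relation.Binary.PropositionalEquality using (_≡_; _≢_)

record LinearSystem (n m : ℕ) : Set where
  field
    line   : Fin m → Subset n
    linear : ∀ i j → i ≢ j → ∣ line i ∩ line j ∣ ≤ 1

open LinearSystem public

Uniform : ∀ {n m} → ℕ → LinearSystem n m → Set
Uniform r S = ∀ i → ∣ line S i ∣ ≡ r

linesThrough : ∀ {n m} → LinearSystem n m → Fin n → Subset m
linesThrough S p = tabulate (λ i → lookup (line S i) p)

degree : ∀ {n m} → LinearSystem n m → Fin n → ℕ
degree S p = ∣ linesThrough S p ∣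

MaxDegree : ∀ {n m} → LinearSystem n m → ℕ → Set
MaxDegree S d = (∀ p → degree S p ≤ d) × ∃ (λ p → degree S p ≡ d)

IsTransversal : ∀ {n m} → LinearSystem n m → Subset n → Set
IsTransversal S T = ∀ i → Nonempty (T ∩ line S i)

Is2Packing : ∀ {n m} → LinearSystem n m → Subset m → Set
Is2Packing S R = ∀ p → ∣ R ∩ linesThrough S p ∣ ≤ 2

Nu2 : ∀ {n m} → LinearSystem n m → ℕ → Set
Nu2 S k = (∃ λ R → Is2Packing S R × ∣ R ∣ ≡ k)
        × (∀ R → Is2Packing S R → ∣ R ∣ ≤ k)

-- Fix a point p of degree 4; its four lines are the spokes. Since ν₂ = 4, any five distinct
-- lines contain three concurrent ones. Call three distinct lines missing p with no common point
-- a triangle. Without triangles the lines missing p form a pencil and are met by at most two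
-- points, which with p give a transversal of size 3; the spokes give |P| ≥ 4r - 3 and |L| ≥ 4.
-- Given a triangle a, b, c, five-line arguments show that each pair of sides meets on a spoke,
-- on three distinct spokes, and that every other line missing p meets a side on the fourth
-- spoke l. So p and the points where a, b, c meet l form a transversal of size 4, and |L| ≥ 7.
module Submission where

open import Defs
open import Data.Bool using (true; false)
open import Data.Empty using (⊥; ⊥-elim)
open import Data.Fin using (Fin; zero; suc)
open import Data.Fin.Properties using (_≟_; any?; suc-injective; 0≢1+n)
open import Data.Fin.Subset
  using (Subset; _∈_; _∉_; _⊆_; _∪_; _∩_; ∁; ⁅_⁆; ∣_∣; Nonempty; Empty)
open import Data.Fin.Subset.Properties
open import Data.Nat using (ℕ; zero; suc; _≤_; _<_; _+_; _*_; z≤n; s≤s)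
open import Data.Nat.Properties
  using (≤-trans; ≤-reflexive; +-monoʳ-≤; +-monoˡ-≤; m≤m+n; +-suc; +-identityʳ; +-comm; +-assoc;
         ≤-pred; <⇒≢; <⇒≱; *-monoˡ-≤; *-suc; module ≤-Reasoning)
open import Data.Product using (∃; _×_; _,_; proj₁; proj₂)
open import Data.Sum using (_⊎_; inj₁; inj₂)
open import Data.Vec using (_∷_; []; lookup)
open import Data.Vec.Properties using (lookup∘tabulate; []=⇒lookup; lookup⇒[]=)
open import Function using (_∘_)
open import Function.Definitions using (Injective)
open import Relation.Nullary using (¬_; Dec; yes; no)
open import Relation.Nullary.Decidable using (_×-dec_; ¬?; map′)
open import Relation.Binary.PropositionalEquality
  using (_≡_; _≢_; ≢-sym; refl; sym; trans; cong; subst; module ≡-Reasoning)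

∣p∪q∣+∣p∩q∣≡∣p∣+∣q∣ : ∀ {k} (p q : Subset k) → ∣ p ∪ q ∣ + ∣ p ∩ q ∣ ≡ ∣ p ∣ + ∣ q ∣
∣p∪q∣+∣p∩q∣≡∣p∣+∣q∣ []           []           = refl
∣p∪q∣+∣p∩q∣≡∣p∣+∣q∣ (true  ∷ p)  (true  ∷ q)  =
  cong suc (trans (+-suc _ _) (trans (cong suc (∣p∪q∣+∣p∩q∣≡∣p∣+∣q∣ p q)) (sym (+-suc _ _))))
∣p∪q∣+∣p∩q∣≡∣p∣+∣q∣ (true  ∷ p)  (false ∷ q)  = cong suc (∣p∪q∣+∣p∩q∣≡∣p∣+∣q∣ p q)
∣p∪q∣+∣p∩q∣≡∣p∣+∣q∣ (false ∷ p)  (true  ∷ q)  =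
  trans (cong suc (∣p∪q∣+∣p∩q∣≡∣p∣+∣q∣ p q)) (sym (+-suc _ _))
∣p∪q∣+∣p∩q∣≡∣p∣+∣q∣ (false ∷ p)  (false ∷ q)  = ∣p∪q∣+∣p∩q∣≡∣p∣+∣q∣ p q

Empty⇒∣p∣≡0 : ∀ {k} {p : Subset k} → Empty p → ∣ p ∣ ≡ 0
Empty⇒∣p∣≡0 {k} empty = trans (cong ∣_∣ (Empty-unique empty)) (∣⊥∣≡0 k)

∣p∪q∣≤∣p∣+∣q∣ : ∀ {k} (p q : Subset k) → ∣ p ∪ q ∣ ≤ ∣ p ∣ + ∣ q ∣
∣p∪q∣≤∣p∣+∣q∣ p q = subst (∣ p ∪ q ∣ ≤_) (∣p∪q∣+∣p∩q∣≡∣p∣+∣q∣ p q) (m≤m+n _ _)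

∣⁅x⁆∪p∣≤1+∣p∣ : ∀ {k} (x : Fin k) (p : Subset k) → ∣ ⁅ x ⁆ ∪ p ∣ ≤ suc ∣ p ∣
∣⁅x⁆∪p∣≤1+∣p∣ x p = subst (λ c → ∣ ⁅ x ⁆ ∪ p ∣ ≤ c + ∣ p ∣) (∣⁅x⁆∣≡1 x) (∣p∪q∣≤∣p∣+∣q∣ ⁅ x ⁆ p)

x∉p⇒∣⁅x⁆∪p∣≡1+∣p∣ : ∀ {k} {x : Fin k} {p : Subset k} → x ∉ p → ∣ ⁅ x ⁆ ∪ p ∣ ≡ suc ∣ p ∣
x∉p⇒∣⁅x⁆∪p∣≡1+∣p∣ {x = x} {p} x∉p = begin
  ∣ ⁅ x ⁆ ∪ p ∣                  ≡⟨ sym (+-identityʳ _) ⟩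
  ∣ ⁅ x ⁆ ∪ p ∣ + 0              ≡⟨ cong (∣ ⁅ x ⁆ ∪ p ∣ +_) (sym ∣⁅x⁆∩p∣≡0) ⟩
  ∣ ⁅ x ⁆ ∪ p ∣ + ∣ ⁅ x ⁆ ∩ p ∣  ≡⟨ ∣p∪q∣+∣p∩q∣≡∣p∣+∣q∣ ⁅ x ⁆ p ⟩
  ∣ ⁅ x ⁆ ∣ + ∣ p ∣              ≡⟨ cong (_+ ∣ p ∣) (∣⁅x⁆∣≡1 x) ⟩
  suc ∣ p ∣                      ∎
  where
  open ≡-Reasoning
  ∣⁅x⁆∩p∣≡0 : ∣ ⁅ x ⁆ ∩ p ∣ ≡ 0
  ∣⁅x⁆∩p∣≡0 = Empty⇒∣p∣≡0 λ (y , y∈) →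
    let (y∈⁅x⁆ , y∈p) = x∈p∩q⁻ ⁅ x ⁆ p y∈ in x∉p (subst (_∈ p) (x∈⁅y⁆⇒x≡y x y∈⁅x⁆) y∈p)

x∉⁅y⁆∪p : ∀ {k} {x y : Fin k} {p : Subset k} → x ≢ y → x ∉ p → x ∉ ⁅ y ⁆ ∪ p
x∉⁅y⁆∪p {p = p} x≢y x∉p x∈ with x∈p∪q⁻ ⁅ _ ⁆ p x∈
... | inj₁ x∈⁅y⁆ = x≢y⇒x∉⁅y⁆ x≢y x∈⁅y⁆
... | inj₂ x∈p   = x∉p x∈p

0<∣p∣⇒Nonempty : ∀ {k} (p : Subset k) → 0 < ∣ p ∣ → Nonempty p
0<∣p∣⇒Nonempty p 0<∣p∣ with nonempty? p
... | yes ne = ne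
... | no ¬ne = ⊥-elim (<⇒≢ 0<∣p∣ (sym (Empty⇒∣p∣≡0 ¬ne)))

∣q∣<∣p∣⇒∃x∈p∧x∉q : ∀ {k} (p q : Subset k) → ∣ q ∣ < ∣ p ∣ → ∃ λ x → x ∈ p × x ∉ q
∣q∣<∣p∣⇒∃x∈p∧x∉q p q ∣q∣<∣p∣ with any? (λ x → (x ∈? p) ×-dec ¬? (x ∈? q))
... | yes found = found
... | no none = ⊥-elim (<⇒≱ ∣q∣<∣p∣ (p⊆q⇒∣p∣≤∣q∣ p⊆q))
  where
  p⊆q : p ⊆ q
  p⊆q {x} x∈p with x ∈? q
  ... | yes x∈q = x∈q
  ... | no  x∉q = ⊥-elim (none (x , x∈p , x∉q))

∣p∣≤1+∣p∩∁⁅x⁆∣ : ∀ {k} (p : Subset k) (x : Fin k) → ∣ p ∣ ≤ suc ∣ p ∩ ∁ ⁅ x ⁆ ∣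
∣p∣≤1+∣p∩∁⁅x⁆∣ p x = ≤-trans (p⊆q⇒∣p∣≤∣q∣ p⊆x∪p∖x) (∣⁅x⁆∪p∣≤1+∣p∣ x _)
  where
  p⊆x∪p∖x : p ⊆ ⁅ x ⁆ ∪ (p ∩ ∁ ⁅ x ⁆)
  p⊆x∪p∖x {y} y∈p with y ≟ x
  ... | yes refl = x∈p∪q⁺ (inj₁ (x∈⁅x⁆ x))
  ... | no  y≢x  = x∈p∪q⁺ (inj₂ (x∈p∩q⁺ (y∈p , x∉p⇒x∈∁p (x≢y⇒x∉⁅y⁆ y≢x))))

distinct-members : ∀ {k l} (X : Subset k) → l ≤ ∣ X ∣ →
                   ∃ λ (f : Fin l → Fin k) → Injective _≡_ _≡_ f × (∀ i → f i ∈ X)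
distinct-members {l = zero}  X _ = (λ ()) , (λ { {()} }) , λ ()
distinct-members {l = suc l} X l<∣X∣
  with x , x∈X ← 0<∣p∣⇒Nonempty X (≤-trans (s≤s z≤n) l<∣X∣)
  with g , g-inj , g∈ ← distinct-members (X ∩ ∁ ⁅ x ⁆) (≤-pred (≤-trans l<∣X∣ (∣p∣≤1+∣p∩∁⁅x⁆∣ X x)))
  = f , f-inj , f∈
  where
  g≢x : ∀ i → g i ≢ x
  g≢x i g≡x = x∈∁p⇒x∉p (proj₂ (x∈p∩q⁻ X _ (g∈ i))) (subst (_∈ ⁅ x ⁆) (sym g≡x) (x∈⁅x⁆ x))
  f : Fin (suc l) → Fin _
  f zero    = x
  f (suc i) = g i
  f-inj : Injective _≡_ _≡_ f
  f-inj {zero}  {zero}  _ = refl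
  f-inj {zero}  {suc j} e = ⊥-elim (g≢x j (sym e))
  f-inj {suc i} {zero}  e = ⊥-elim (g≢x i e)
  f-inj {suc i} {suc j} e = cong suc (g-inj e)
  f∈ : ∀ i → f i ∈ X
  f∈ zero    = x∈X
  f∈ (suc i) = proj₁ (x∈p∩q⁻ X _ (g∈ i))

Nonempty-∩ : ∀ {k} {x : Fin k} {p q : Subset k} → x ∈ p → x ∈ q → Nonempty (p ∩ q)
Nonempty-∩ x∈p x∈q = _ , x∈p∩q⁺ (x∈p , x∈q)

∈⁅x⁆∪⁅y⁆ : ∀ {k} {w x y : Fin k} → w ≡ x ⊎ w ≡ y → w ∈ ⁅ x ⁆ ∪ ⁅ y ⁆
∈⁅x⁆∪⁅y⁆ (inj₁ refl) = x∈p∪q⁺ (inj₁ (x∈⁅x⁆ _))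
∈⁅x⁆∪⁅y⁆ (inj₂ refl) = x∈p∪q⁺ (inj₂ (x∈⁅x⁆ _))

∈⁅x⁆∪⁅y⁆∪⁅z⁆ : ∀ {k} {w x y z : Fin k} → w ≡ x ⊎ w ≡ y ⊎ w ≡ z → w ∈ ⁅ x ⁆ ∪ ⁅ y ⁆ ∪ ⁅ z ⁆
∈⁅x⁆∪⁅y⁆∪⁅z⁆ (inj₁ refl) = x∈p∪q⁺ (inj₁ (x∈⁅x⁆ _))
∈⁅x⁆∪⁅y⁆∪⁅z⁆ (inj₂ w≡y⊎w≡z) = x∈p∪q⁺ (inj₂ (∈⁅x⁆∪⁅y⁆ w≡y⊎w≡z))

∣⁅x⁆∪⁅y⁆∣≤2 : ∀ {k} (x y : Fin k) → ∣ ⁅ x ⁆ ∪ ⁅ y ⁆ ∣ ≤ 2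
∣⁅x⁆∪⁅y⁆∣≤2 x y = ≤-trans (∣⁅x⁆∪p∣≤1+∣p∣ x ⁅ y ⁆) (s≤s (≤-reflexive (∣⁅x⁆∣≡1 y)))

∣⁅x⁆∪⁅y⁆∪⁅z⁆∣≤3 : ∀ {k} (x y z : Fin k) → ∣ ⁅ x ⁆ ∪ ⁅ y ⁆ ∪ ⁅ z ⁆ ∣ ≤ 3
∣⁅x⁆∪⁅y⁆∪⁅z⁆∣≤3 x y z = ≤-trans (∣⁅x⁆∪p∣≤1+∣p∣ x _) (s≤s (∣⁅x⁆∪⁅y⁆∣≤2 y z))

𝟙 : ∀ {A : Set} → Dec A → ℕ
𝟙 (yes _) = 1
𝟙 (no _)  = 0

at-most-two-of-five : ∀ {A₁ A₂ A₃ A₄ A₅ : Set} (d₁ : Dec A₁) (d₂ : Dec A₂) (d₃ : Dec A₃) (d₄ : Dec A₄) (d₅ : Dec A₅)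
  → (A₁ → A₂ → A₃ → ⊥) → (A₁ → A₂ → A₄ → ⊥) → (A₁ → A₂ → A₅ → ⊥) → (A₁ → A₃ → A₄ → ⊥) → (A₁ → A₃ → A₅ → ⊥)
  → (A₁ → A₄ → A₅ → ⊥) → (A₂ → A₃ → A₄ → ⊥) → (A₂ → A₃ → A₅ → ⊥) → (A₂ → A₄ → A₅ → ⊥) → (A₃ → A₄ → A₅ → ⊥)
  → 𝟙 d₁ + (𝟙 d₂ + (𝟙 d₃ + (𝟙 d₄ + 𝟙 d₅))) ≤ 2
at-most-two-of-five (yes a₁) (yes a₂) (yes a₃) _ _ h _ _ _ _ _ _ _ _ _ = ⊥-elim (h a₁ a₂ a₃)
at-most-two-of-five (yes a₁) (yes a₂) _ (yes a₄) _ _ h _ _ _ _ _ _ _ _ = ⊥-elim (h a₁ a₂ a₄)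
at-most-two-of-five (yes a₁) (yes a₂) _ _ (yes a₅) _ _ h _ _ _ _ _ _ _ = ⊥-elim (h a₁ a₂ a₅)
at-most-two-of-five (yes a₁) _ (yes a₃) (yes a₄) _ _ _ _ h _ _ _ _ _ _ = ⊥-elim (h a₁ a₃ a₄)
at-most-two-of-five (yes a₁) _ (yes a₃) _ (yes a₅) _ _ _ _ h _ _ _ _ _ = ⊥-elim (h a₁ a₃ a₅)
at-most-two-of-five (yes a₁) _ _ (yes a₄) (yes a₅) _ _ _ _ _ h _ _ _ _ = ⊥-elim (h a₁ a₄ a₅)
at-most-two-of-five _ (yes a₂) (yes a₃) (yes a₄) _ _ _ _ _ _ _ h _ _ _ = ⊥-elim (h a₂ a₃ a₄)
at-most-two-of-five _ (yes a₂) (yes a₃) _ (yes a₅) _ _ _ _ _ _ _ h _ _ = ⊥-elim (h a₂ a₃ a₅)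
at-most-two-of-five _ (yes a₂) _ (yes a₄) (yes a₅) _ _ _ _ _ _ _ _ h _ = ⊥-elim (h a₂ a₄ a₅)
at-most-two-of-five _ _ (yes a₃) (yes a₄) (yes a₅) _ _ _ _ _ _ _ _ _ h = ⊥-elim (h a₃ a₄ a₅)
at-most-two-of-five (no _)  (no _)  (no _)  (no _)  (no _)  _ _ _ _ _ _ _ _ _ _ = z≤n
at-most-two-of-five (no _)  (no _)  (no _)  (no _)  (yes _) _ _ _ _ _ _ _ _ _ _ = s≤s z≤n
at-most-two-of-five (no _)  (no _)  (no _)  (yes _) (no _)  _ _ _ _ _ _ _ _ _ _ = s≤s z≤n
at-most-two-of-five (no _)  (no _)  (no _)  (yes _) (yes _) _ _ _ _ _ _ _ _ _ _ = s≤s (s≤s z≤n)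
at-most-two-of-five (no _)  (no _)  (yes _) (no _)  (no _)  _ _ _ _ _ _ _ _ _ _ = s≤s z≤n
at-most-two-of-five (no _)  (no _)  (yes _) (no _)  (yes _) _ _ _ _ _ _ _ _ _ _ = s≤s (s≤s z≤n)
at-most-two-of-five (no _)  (no _)  (yes _) (yes _) (no _)  _ _ _ _ _ _ _ _ _ _ = s≤s (s≤s z≤n)
at-most-two-of-five (no _)  (yes _) (no _)  (no _)  (no _)  _ _ _ _ _ _ _ _ _ _ = s≤s z≤n
at-most-two-of-five (no _)  (yes _) (no _)  (no _)  (yes _) _ _ _ _ _ _ _ _ _ _ = s≤s (s≤s z≤n)
at-most-two-of-five (no _)  (yes _) (no _)  (yes _) (no _)  _ _ _ _ _ _ _ _ _ _ = s≤s (s≤s z≤n)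
at-most-two-of-five (no _)  (yes _) (yes _) (no _)  (no _)  _ _ _ _ _ _ _ _ _ _ = s≤s (s≤s z≤n)
at-most-two-of-five (yes _) (no _)  (no _)  (no _)  (no _)  _ _ _ _ _ _ _ _ _ _ = s≤s z≤n
at-most-two-of-five (yes _) (no _)  (no _)  (no _)  (yes _) _ _ _ _ _ _ _ _ _ _ = s≤s (s≤s z≤n)
at-most-two-of-five (yes _) (no _)  (no _)  (yes _) (no _)  _ _ _ _ _ _ _ _ _ _ = s≤s (s≤s z≤n)
at-most-two-of-five (yes _) (no _)  (yes _) (no _)  (no _)  _ _ _ _ _ _ _ _ _ _ = s≤s (s≤s z≤n)
at-most-two-of-five (yes _) (yes _) (no _)  (no _)  (no _)  _ _ _ _ _ _ _ _ _ _ = s≤s (s≤s z≤n)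

module Incidence {n m : ℕ} (S : LinearSystem n m) where

  L : Fin m → Subset n
  L = line S

  ∈linesThrough⁻ : ∀ {q i} → i ∈ linesThrough S q → q ∈ L i
  ∈linesThrough⁻ {q} {i} i∈ =
    lookup⇒[]= q (L i) (trans (sym (lookup∘tabulate (λ j → lookup (L j) q) i)) ([]=⇒lookup i∈))

  lines-meet-once : ∀ {i j} → i ≢ j → ∀ {q q′} → q ∈ L i → q ∈ L j → q′ ∈ L i → q′ ∈ L j → q ≡ q′
  lines-meet-once {i} {j} i≢j {q} {q′} q∈i q∈j q′∈i q′∈j with q ≟ q′
  ... | yes q≡q′ = q≡q′
  ... | no  q≢q′ = ⊥-elim (<⇒≱ 2≤∣i∩j∣ (linear S i j i≢j))
    where
    pair⊆i∩j : ⁅ q ⁆ ∪ ⁅ q′ ⁆ ⊆ L i ∩ L j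
    pair⊆i∩j x∈ with x∈p∪q⁻ ⁅ q ⁆ ⁅ q′ ⁆ x∈
    ... | inj₁ x∈⁅q⁆  = subst (_∈ L i ∩ L j) (sym (x∈⁅y⁆⇒x≡y q x∈⁅q⁆)) (x∈p∩q⁺ (q∈i , q∈j))
    ... | inj₂ x∈⁅q′⁆ = subst (_∈ L i ∩ L j) (sym (x∈⁅y⁆⇒x≡y q′ x∈⁅q′⁆)) (x∈p∩q⁺ (q′∈i , q′∈j))
    2≤∣i∩j∣ : 2 ≤ ∣ L i ∩ L j ∣
    2≤∣i∩j∣ = ≤-trans (≤-reflexive (sym (trans (x∉p⇒∣⁅x⁆∪p∣≡1+∣p∣ (x≢y⇒x∉⁅y⁆ q≢q′)) (cong suc (∣⁅x⁆∣≡1 q′)))))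
                      (p⊆q⇒∣p∣≤∣q∣ pair⊆i∩j)

  Concurrent : Fin m → Fin m → Fin m → Set
  Concurrent a b c = ∃ λ q → q ∈ L a × q ∈ L b × q ∈ L c

  concurrent? : ∀ a b c → Dec (Concurrent a b c)
  concurrent? a b c = any? λ q → (q ∈? L a) ×-dec (q ∈? L b) ×-dec (q ∈? L c)

  module _ (ν₂≤4 : ∀ R → Is2Packing S R → ∣ R ∣ ≤ 4) where

    -- Otherwise the five lines are a 2-packing.
    concurrent-triple-among-five : ∀ {u₁ u₂ u₃ u₄ u₅}
      → u₁ ≢ u₂ → u₁ ≢ u₃ → u₁ ≢ u₄ → u₁ ≢ u₅ → u₂ ≢ u₃ → u₂ ≢ u₄ → u₂ ≢ u₅ → u₃ ≢ u₄ → u₃ ≢ u₅ → u₄ ≢ u₅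
      → ¬ Concurrent u₁ u₂ u₃ → ¬ Concurrent u₁ u₂ u₄ → ¬ Concurrent u₁ u₂ u₅ → ¬ Concurrent u₁ u₃ u₄
      → ¬ Concurrent u₁ u₃ u₅ → ¬ Concurrent u₁ u₄ u₅ → ¬ Concurrent u₂ u₃ u₄ → ¬ Concurrent u₂ u₃ u₅
      → ¬ Concurrent u₂ u₄ u₅ → ¬ Concurrent u₃ u₄ u₅ → ⊥
    concurrent-triple-among-five {u₁} {u₂} {u₃} {u₄} {u₅} d₁₂ d₁₃ d₁₄ d₁₅ d₂₃ d₂₄ d₂₅ d₃₄ d₃₅ d₄₅
                                 c₁₂₃ c₁₂₄ c₁₂₅ c₁₃₄ c₁₃₅ c₁₄₅ c₂₃₄ c₂₃₅ c₂₄₅ c₃₄₅ =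
      <⇒≱ (≤-reflexive (sym ∣R∣≡5)) (ν₂≤4 R packing)
      where
      R : Subset m
      R = ⁅ u₁ ⁆ ∪ ⁅ u₂ ⁆ ∪ ⁅ u₃ ⁆ ∪ ⁅ u₄ ⁆ ∪ ⁅ u₅ ⁆

      ∣R∣≡5 : ∣ R ∣ ≡ 5
      ∣R∣≡5 =
        trans (x∉p⇒∣⁅x⁆∪p∣≡1+∣p∣ (x∉⁅y⁆∪p d₁₂ (x∉⁅y⁆∪p d₁₃ (x∉⁅y⁆∪p d₁₄ (x≢y⇒x∉⁅y⁆ d₁₅))))) (cong suc
        (trans (x∉p⇒∣⁅x⁆∪p∣≡1+∣p∣ (x∉⁅y⁆∪p d₂₃ (x∉⁅y⁆∪p d₂₄ (x≢y⇒x∉⁅y⁆ d₂₅)))) (cong suc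
        (trans (x∉p⇒∣⁅x⁆∪p∣≡1+∣p∣ (x∉⁅y⁆∪p d₃₄ (x≢y⇒x∉⁅y⁆ d₃₅))) (cong suc
        (trans (x∉p⇒∣⁅x⁆∪p∣≡1+∣p∣ (x≢y⇒x∉⁅y⁆ d₄₅)) (cong suc (∣⁅x⁆∣≡1 u₅))))))))

      ∣⁅u⁆∩X∣≤𝟙 : ∀ q u → ∣ ⁅ u ⁆ ∩ linesThrough S q ∣ ≤ 𝟙 (q ∈? L u)
      ∣⁅u⁆∩X∣≤𝟙 q u with q ∈? L u
      ... | yes _   = ≤-trans (∣p∩q∣≤∣p∣ ⁅ u ⁆ _) (≤-reflexive (∣⁅x⁆∣≡1 u))
      ... | no  q∉u = ≤-reflexive (Empty⇒∣p∣≡0 λ (v , v∈) →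
          let (v∈⁅u⁆ , v∈X) = x∈p∩q⁻ ⁅ u ⁆ _ v∈
          in q∉u (∈linesThrough⁻ (subst (_∈ linesThrough S q) (x∈⁅y⁆⇒x≡y u v∈⁅u⁆) v∈X)))

      ∣⁅u⁆∪Y∩X∣≤𝟙+∣Y∩X∣ : ∀ q u (Y : Subset m) →
        ∣ (⁅ u ⁆ ∪ Y) ∩ linesThrough S q ∣ ≤ 𝟙 (q ∈? L u) + ∣ Y ∩ linesThrough S q ∣
      ∣⁅u⁆∪Y∩X∣≤𝟙+∣Y∩X∣ q u Y =
        ≤-trans (≤-reflexive (cong ∣_∣ (∩-distribʳ-∪ X ⁅ u ⁆ Y)))
        (≤-trans (∣p∪q∣≤∣p∣+∣q∣ (⁅ u ⁆ ∩ X) (Y ∩ X)) (+-monoˡ-≤ _ (∣⁅u⁆∩X∣≤𝟙 q u)))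
        where X = linesThrough S q

      packing : Is2Packing S R
      packing q = ≤-trans
        (≤-trans (∣⁅u⁆∪Y∩X∣≤𝟙+∣Y∩X∣ q u₁ _) (+-monoʳ-≤ (𝟙 (q ∈? L u₁))
        (≤-trans (∣⁅u⁆∪Y∩X∣≤𝟙+∣Y∩X∣ q u₂ _) (+-monoʳ-≤ (𝟙 (q ∈? L u₂))
        (≤-trans (∣⁅u⁆∪Y∩X∣≤𝟙+∣Y∩X∣ q u₃ _) (+-monoʳ-≤ (𝟙 (q ∈? L u₃))
        (≤-trans (∣⁅u⁆∪Y∩X∣≤𝟙+∣Y∩X∣ q u₄ _) (+-monoʳ-≤ (𝟙 (q ∈? L u₄)) (∣⁅u⁆∩X∣≤𝟙 q u₅)))))))))
        (at-most-two-of-five (q ∈? L u₁) (q ∈? L u₂) (q ∈? L u₃) (q ∈? L u₄) (q ∈? L u₅)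
          (at q c₁₂₃) (at q c₁₂₄) (at q c₁₂₅) (at q c₁₃₄) (at q c₁₃₅)
          (at q c₁₄₅) (at q c₂₃₄) (at q c₂₃₅) (at q c₂₄₅) (at q c₃₄₅))
        where
        at : ∀ q {a b c} → ¬ Concurrent a b c → q ∈ L a → q ∈ L b → q ∈ L c → ⊥
        at q ¬abc qa qb qc = ¬abc (q , qa , qb , qc)

  star : Fin n → ∀ {k} → (Fin k → Fin m) → Subset n
  star p {zero}  K = ⁅ p ⁆
  star p {suc k} K = L (K zero) ∪ star p (K ∘ suc)

  ∈star⁻ : ∀ {p q k} (K : Fin k → Fin m) → q ∈ star p K → q ≡ p ⊎ ∃ λ i → q ∈ L (K i)
  ∈star⁻ {p} {k = zero}  K q∈ = inj₁ (x∈⁅y⁆⇒x≡y p q∈)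
  ∈star⁻ {k = suc k} K q∈ with x∈p∪q⁻ (L (K zero)) _ q∈
  ... | inj₁ q∈K₀ = inj₂ (zero , q∈K₀)
  ... | inj₂ q∈star with ∈star⁻ (K ∘ suc) q∈star
  ...   | inj₁ q≡p       = inj₁ q≡p
  ...   | inj₂ (i , q∈Kᵢ) = inj₂ (suc i , q∈Kᵢ)

  -- Lines through p pairwise meet only in p, so each adds at least r - 1 new points.
  ∣star∣-bound : ∀ {p r k} (K : Fin k → Fin m) → Uniform r S → Injective _≡_ _≡_ K → (∀ i → p ∈ L (K i))
               → k * r + 1 ≤ ∣ star p K ∣ + k
  ∣star∣-bound {p} {k = zero} K _ _ _ = ≤-reflexive (cong (_+ 0) (sym (∣⁅x⁆∣≡1 p)))
  ∣star∣-bound {p} {r} {suc k} K uniform K-inj p∈K = begin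
    suc k * r + 1                          ≡⟨ +-assoc r (k * r) 1 ⟩
    r + (k * r + 1)                        ≤⟨ +-monoʳ-≤ r (∣star∣-bound (K ∘ suc) uniform (suc-injective ∘ K-inj) (p∈K ∘ suc)) ⟩
    r + (∣ B ∣ + k)                        ≡⟨ sym (+-assoc r ∣ B ∣ k) ⟩
    r + ∣ B ∣ + k                          ≡⟨ cong (λ x → x + ∣ B ∣ + k) (sym (uniform (K zero))) ⟩
    ∣ A ∣ + ∣ B ∣ + k                      ≡⟨ cong (_+ k) (sym (∣p∪q∣+∣p∩q∣≡∣p∣+∣q∣ A B)) ⟩
    ∣ A ∪ B ∣ + ∣ A ∩ B ∣ + k              ≤⟨ +-monoˡ-≤ k (+-monoʳ-≤ ∣ A ∪ B ∣ ∣A∩B∣≤1) ⟩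
    ∣ A ∪ B ∣ + 1 + k                      ≡⟨ +-assoc ∣ A ∪ B ∣ 1 k ⟩
    ∣ A ∪ B ∣ + suc k                      ∎
    where
    open ≤-Reasoning
    A = L (K zero)
    B = star p (K ∘ suc)
    A∩B⊆⁅p⁆ : A ∩ B ⊆ ⁅ p ⁆
    A∩B⊆⁅p⁆ {q} q∈ with x∈p∩q⁻ A B q∈
    ... | q∈A , q∈B with ∈star⁻ (K ∘ suc) q∈B
    ...   | inj₁ refl          = x∈⁅x⁆ p
    ...   | inj₂ (i , q∈Kᵢ) =
      subst (_∈ ⁅ p ⁆) (sym (lines-meet-once (0≢1+n ∘ K-inj) q∈A q∈Kᵢ (p∈K zero) (p∈K (suc i)))) (x∈⁅x⁆ p)
    ∣A∩B∣≤1 : ∣ A ∩ B ∣ ≤ 1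
    ∣A∩B∣≤1 = ≤-trans (p⊆q⇒∣p∣≤∣q∣ A∩B⊆⁅p⁆) (≤-reflexive (∣⁅x⁆∣≡1 p))

  lines-through-bound : ∀ {r k} → Uniform r S → ∀ p → k ≤ ∣ linesThrough S p ∣ → k * r + 1 ≤ n + k
  lines-through-bound {r} {k} uniform p k≤deg = bound-from-spokes (distinct-members (linesThrough S p) k≤deg)
    where
    bound-from-spokes : (∃ λ (K : Fin k → Fin m) → Injective _≡_ _≡_ K × (∀ i → K i ∈ linesThrough S p)) → k * r + 1 ≤ n + k
    bound-from-spokes (K , K-inj , K∈) = ≤-trans (∣star∣-bound K uniform K-inj (∈linesThrough⁻ ∘ K∈)) (+-monoˡ-≤ k (∣p∣≤n (star p K)))

3*[1+r]≤n+m : ∀ {r n m} → 2 ≤ r → 4 * r + 1 ≤ n + 4 → 4 ≤ m → 3 * suc r ≤ n + m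
3*[1+r]≤n+m {r} {n} {m} 2≤r 4r+1≤n+4 4≤m = begin
  3 * suc r    ≡⟨ *-suc 3 r ⟩
  3 + 3 * r    ≤⟨ +-monoˡ-≤ (3 * r) (s≤s 2≤r) ⟩
  suc (4 * r)  ≡⟨ +-comm 1 (4 * r) ⟩
  4 * r + 1    ≤⟨ 4r+1≤n+4 ⟩
  n + 4        ≤⟨ +-monoʳ-≤ n 4≤m ⟩
  n + m        ∎
  where open ≤-Reasoning

4*[1+r]≤n+m : ∀ {r n m} → 4 * r + 1 ≤ n + 4 → 7 ≤ m → 4 * suc r ≤ n + m
4*[1+r]≤n+m {r} {n} {m} 4r+1≤n+4 7≤m = begin
  4 * suc r          ≡⟨ *-suc 4 r ⟩
  3 + (1 + 4 * r)    ≡⟨ cong (3 +_) (+-comm 1 (4 * r)) ⟩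
  3 + (4 * r + 1)    ≤⟨ +-monoʳ-≤ 3 4r+1≤n+4 ⟩
  3 + (n + 4)        ≡⟨ +-comm 3 (n + 4) ⟩
  n + 4 + 3          ≡⟨ +-assoc n 4 3 ⟩
  n + 7              ≤⟨ +-monoʳ-≤ n 7≤m ⟩
  n + m              ∎
  where open ≤-Reasoning

module Centred {n m : ℕ} (S : LinearSystem n m) (ν₂≤4 : ∀ R → Is2Packing S R → ∣ R ∣ ≤ 4)
               (p : Fin n) (deg≡4 : degree S p ≡ 4) (nonempty : ∀ e → Nonempty (line S e)) where

  open Incidence S

  Spoke Outer : Fin m → Set
  Spoke k = p ∈ L k
  Outer e = p ∉ L e

  spokes : Subset m
  spokes = linesThrough S p

  outer≢spoke : ∀ {e k} → Outer e → Spoke k → e ≢ k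
  outer≢spoke p∉e p∈k refl = p∉e p∈k

  spoke-unique : ∀ {e k k′ q} → Outer e → q ∈ L e → Spoke k → Spoke k′ → q ∈ L k → q ∈ L k′ → k ≡ k′
  spoke-unique {k = k} {k′} p∉e q∈e p∈k p∈k′ q∈k q∈k′ with k ≟ k′
  ... | yes k≡k′ = k≡k′
  ... | no  k≢k′ = ⊥-elim (p∉e (subst (_∈ L _) (lines-meet-once k≢k′ q∈k q∈k′ p∈k p∈k′) q∈e))

  ¬Concurrent-through : ∀ {a b e x} → a ≢ b → x ∈ L a → x ∈ L b → x ∉ L e → ¬ Concurrent a b e
  ¬Concurrent-through a≢b x∈a x∈b x∉e (q , q∈a , q∈b , q∈e) =
    x∉e (subst (_∈ L _) (lines-meet-once a≢b q∈a q∈b x∈a x∈b) q∈e)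

  ¬Concurrent-spokes : ∀ {e i j} → Outer e → Spoke i → Spoke j → i ≢ j → ¬ Concurrent e i j
  ¬Concurrent-spokes p∉e p∈i p∈j i≢j (q , q∈e , q∈i , q∈j) =
    p∉e (subst (_∈ L _) (lines-meet-once i≢j q∈i q∈j p∈i p∈j) q∈e)

  spoke-avoiding : ∀ k₁ k₂ k₃ → ∃ λ l → Spoke l × l ≢ k₁ × l ≢ k₂ × l ≢ k₃
  spoke-avoiding k₁ k₂ k₃
    with l , l∈spokes , l∉ks ← ∣q∣<∣p∣⇒∃x∈p∧x∉q spokes (⁅ k₁ ⁆ ∪ ⁅ k₂ ⁆ ∪ ⁅ k₃ ⁆)
                                 (≤-trans (s≤s (∣⁅x⁆∪⁅y⁆∪⁅z⁆∣≤3 k₁ k₂ k₃)) (≤-reflexive (sym deg≡4)))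
    = l , ∈linesThrough⁻ l∈spokes , (l∉ks ∘ ∈⁅x⁆∪⁅y⁆∪⁅z⁆ ∘ inj₁)
        , (l∉ks ∘ ∈⁅x⁆∪⁅y⁆∪⁅z⁆ ∘ inj₂ ∘ inj₁) , (l∉ks ∘ ∈⁅x⁆∪⁅y⁆∪⁅z⁆ ∘ inj₂ ∘ inj₂)

  -- The sides need not meet pairwise.
  record Triangle (a b c : Fin m) : Set where
    field
      outer₁ : Outer a
      outer₂ : Outer b
      outer₃ : Outer c
      a≢b    : a ≢ b
      a≢c    : a ≢ c
      b≢c    : b ≢ c
      no-common-point : ¬ Concurrent a b c

  rotate : ∀ {a b c} → Triangle a b c → Triangle b c a
  rotate t = record
    { outer₁ = outer₂ ; outer₂ = outer₃ ; outer₃ = outer₁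
    ; a≢b = b≢c ; a≢c = ≢-sym a≢b ; b≢c = ≢-sym a≢c
    ; no-common-point = λ (q , q∈b , q∈c , q∈a) → no-common-point (q , q∈a , q∈b , q∈c) }
    where open Triangle t

  swap : ∀ {a b c} → Triangle a b c → Triangle b a c
  swap t = record
    { outer₁ = outer₂ ; outer₂ = outer₁ ; outer₃ = outer₃
    ; a≢b = ≢-sym a≢b ; a≢c = b≢c ; b≢c = a≢c
    ; no-common-point = λ (q , q∈b , q∈a , q∈c) → no-common-point (q , q∈a , q∈b , q∈c) }
    where open Triangle t

  triangle? : ∀ a b c → Dec (Triangle a b c)
  triangle? a b c =
    map′ (λ (oa , ob , oc , ab , ac , bc , nc) → record
            { outer₁ = oa ; outer₂ = ob ; outer₃ = oc ; a≢b = ab ; a≢c = ac ; b≢c = bc ; no-common-point = nc })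
         (λ t → let open Triangle t in outer₁ , outer₂ , outer₃ , a≢b , a≢c , b≢c , no-common-point)
         (¬? (p ∈? L a) ×-dec ¬? (p ∈? L b) ×-dec ¬? (p ∈? L c)
           ×-dec ¬? (a ≟ b) ×-dec ¬? (a ≟ c) ×-dec ¬? (b ≟ c) ×-dec ¬? (concurrent? a b c))

  two-spokes-and-triangle : ∀ {a b c i j} → Triangle a b c → Spoke i → Spoke j → i ≢ j
    → ¬ Concurrent a b i → ¬ Concurrent a c i → ¬ Concurrent b c i
    → ¬ Concurrent a b j → ¬ Concurrent a c j → ¬ Concurrent b c j → ⊥
  two-spokes-and-triangle t p∈i p∈j i≢j ¬abi ¬aci ¬bci ¬abj ¬acj ¬bcj =
    concurrent-triple-among-five ν₂≤4 a≢b a≢c (outer≢spoke outer₁ p∈i) (outer≢spoke outer₁ p∈j)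
      b≢c (outer≢spoke outer₂ p∈i) (outer≢spoke outer₂ p∈j) (outer≢spoke outer₃ p∈i) (outer≢spoke outer₃ p∈j) i≢j
      no-common-point ¬abi ¬abj ¬aci ¬acj (¬Concurrent-spokes outer₁ p∈i p∈j i≢j)
      ¬bci ¬bcj (¬Concurrent-spokes outer₂ p∈i p∈j i≢j) (¬Concurrent-spokes outer₃ p∈i p∈j i≢j)
    where open Triangle t

  record Corner (e f : Fin m) : Set where
    constructor corner
    field
      point    : Fin n
      spoke    : Fin m
      p∈spoke  : Spoke spoke
      point∈₁  : point ∈ L e
      point∈₂  : point ∈ L f
      point∈spoke : point ∈ L spoke

  flip : ∀ {e f} → Corner e f → Corner f e
  flip (corner x k p∈k x∈e x∈f x∈k) = corner x k p∈k x∈f x∈e x∈k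

  corner∉other-spoke : ∀ {e f l} (x : Corner e f) → Outer e → Spoke l → l ≢ Corner.spoke x → Corner.point x ∉ L l
  corner∉other-spoke (corner x k p∈k x∈e _ x∈k) p∉e p∈l l≢k x∈l = l≢k (spoke-unique p∉e x∈e p∈l p∈k x∈l x∈k)

  corners-not-on-one-spoke : ∀ {a b c k x y} → Triangle a b c → Spoke k
    → x ∈ L a → x ∈ L b → x ∈ L k → y ∈ L a → y ∈ L c → y ∈ L k → ⊥
  corners-not-on-one-spoke t p∈k x∈a x∈b x∈k y∈a y∈c y∈k =
    no-common-point (_ , y∈a , subst (_∈ L _) (lines-meet-once (outer≢spoke outer₁ p∈k) x∈a x∈k y∈a y∈k) x∈b , y∈c)
    where open Triangle t

  corner-spoke-candidate : ∀ {e f} → Outer e → e ≢ f → ∃ λ k₀ → ∀ {k} → Spoke k → Concurrent e f k → k ≡ k₀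
  corner-spoke-candidate {e} {f} p∉e e≢f with any? (λ k → (p ∈? L k) ×-dec concurrent? e f k)
  ... | yes (k₀ , p∈k₀ , (x , x∈e , x∈f , x∈k₀)) = k₀ , λ p∈k (y , y∈e , y∈f , y∈k) →
        spoke-unique p∉e x∈e p∈k p∈k₀ (subst (_∈ L _) (lines-meet-once e≢f y∈e y∈f x∈e x∈f) y∈k) x∈k₀
  ... | no none = e , λ p∈k efk → ⊥-elim (none (_ , p∈k , efk))

  -- Two spokes avoiding the possible corner spokes of ac and bc, together with the
  -- triangle, are five lines; the concurrent triple they must contain puts a ∩ b on a spoke.
  side-corner : ∀ {a b c} → Triangle a b c → Corner a b
  side-corner {a} {b} {c} t
    with c₁ , ac-on-c₁ ← corner-spoke-candidate (Triangle.outer₁ t) (Triangle.a≢c t)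
       | c₂ , bc-on-c₂ ← corner-spoke-candidate (Triangle.outer₂ t) (Triangle.b≢c t)
    with i , p∈i , i≢c₁ , i≢c₂ , _ ← spoke-avoiding c₁ c₂ c₂
    with j , p∈j , j≢c₁ , j≢c₂ , j≢i ← spoke-avoiding c₁ c₂ i
    with concurrent? a b i | concurrent? a b j
  ... | yes (x , x∈a , x∈b , x∈i) | _ = corner x i p∈i x∈a x∈b x∈i
  ... | no _ | yes (x , x∈a , x∈b , x∈j) = corner x j p∈j x∈a x∈b x∈j
  ... | no ¬abi | no ¬abj =
    ⊥-elim (two-spokes-and-triangle t p∈i p∈j (≢-sym j≢i)
      ¬abi (i≢c₁ ∘ ac-on-c₁ p∈i) (i≢c₂ ∘ bc-on-c₂ p∈i) ¬abj (j≢c₁ ∘ ac-on-c₁ p∈j) (j≢c₂ ∘ bc-on-c₂ p∈j))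

  -- Otherwise the spokes of s and l together with R, P, d would be five lines with no concurrent triple.
  line-through-corner-meets-opposite-side : ∀ {P Q R l d} → Triangle P Q R
    → (u : Corner Q R) (s : Corner P Q) (w : Corner P R)
    → Spoke l → l ≢ Corner.spoke u → l ≢ Corner.spoke s → l ≢ Corner.spoke w
    → Outer d → P ≢ d → Q ≢ d → R ≢ d → Corner.point u ∈ L d → Concurrent P d l
  line-through-corner-meets-opposite-side {P} {Q} {R} {l} {d} t
    u@(corner xᵤ _ _ u∈Q u∈R _) (corner xₛ kₛ p∈kₛ s∈P s∈Q s∈kₛ) w@(corner _ _ _ w∈P w∈R _)
    p∈l l≢kᵤ l≢kₛ l≢k_w p∉d P≢d Q≢d R≢d u∈d with concurrent? P d l
  ... | yes Pdl = Pdl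
  ... | no ¬Pdl = ⊥-elim (two-spokes-and-triangle RPd p∈kₛ p∈l (≢-sym l≢kₛ)
          (¬Concurrent-through R≢P w∈R w∈P (corners-not-on-one-spoke t p∈kₛ s∈P s∈Q s∈kₛ w∈P w∈R))
          (¬Concurrent-through R≢d u∈R u∈d u∉kₛ)
          (λ (q , q∈P , q∈d , q∈kₛ) →
             u∉kₛ (subst (_∈ L kₛ) (lines-meet-once Q≢d s∈Q (s∈d q∈P q∈d q∈kₛ) u∈Q u∈d) s∈kₛ))
          (¬Concurrent-through R≢P w∈R w∈P (corner∉other-spoke (flip w) outer₃ p∈l l≢k_w))
          (¬Concurrent-through R≢d u∈R u∈d (corner∉other-spoke (flip u) outer₃ p∈l l≢kᵤ))
          ¬Pdl)
    where
    open Triangle t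
    R≢P = ≢-sym a≢c
    u∉kₛ : xᵤ ∉ L kₛ
    u∉kₛ = corners-not-on-one-spoke (swap t) p∈kₛ s∈Q s∈P s∈kₛ u∈Q u∈R
    s∈d : ∀ {q} → q ∈ L P → q ∈ L d → q ∈ L kₛ → xₛ ∈ L d
    s∈d q∈P q∈d q∈kₛ = subst (_∈ L d) (lines-meet-once (outer≢spoke outer₁ p∈kₛ) q∈P q∈kₛ s∈P s∈kₛ) q∈d
    RPd : Triangle R P d
    RPd = record
      { outer₁ = outer₃ ; outer₂ = outer₁ ; outer₃ = p∉d ; a≢b = R≢P ; a≢c = R≢d ; b≢c = P≢d
      ; no-common-point = λ (q , q∈R , q∈P , q∈d) →
          let q≡u = lines-meet-once R≢d q∈R q∈d u∈R u∈d
          in no-common-point (xᵤ , subst (_∈ L P) q≡u q∈P , u∈Q , u∈R) }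

  -- Otherwise l, a, b, c, d would be five lines with no concurrent triple.
  line-meets-a-corner : ∀ {a b c l d} → Triangle a b c → (x : Corner a b) (y : Corner a c) (z : Corner b c)
    → Spoke l → l ≢ Corner.spoke x → l ≢ Corner.spoke y → l ≢ Corner.spoke z
    → Outer d → a ≢ d → b ≢ d → c ≢ d → ¬ Concurrent a d l → ¬ Concurrent b d l → ¬ Concurrent c d l
    → Corner.point x ∈ L d ⊎ Corner.point y ∈ L d ⊎ Corner.point z ∈ L d
  line-meets-a-corner {d = d} t x y z p∈l l≢kx l≢ky l≢kz p∉d a≢d b≢d c≢d ¬adl ¬bdl ¬cdl
    with Corner.point x ∈? L d | Corner.point y ∈? L d | Corner.point z ∈? L d
  ... | yes x∈d | _       | _       = inj₁ x∈d
  ... | no _    | yes y∈d | _       = inj₂ (inj₁ y∈d)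
  ... | no _    | no _    | yes z∈d = inj₂ (inj₂ z∈d)
  ... | no x∉d  | no y∉d  | no z∉d  = ⊥-elim (concurrent-triple-among-five ν₂≤4
          a≢b a≢c a≢d (outer≢spoke outer₁ p∈l) b≢c b≢d (outer≢spoke outer₂ p∈l) c≢d (outer≢spoke outer₃ p∈l)
          (outer≢spoke p∉d p∈l)
          no-common-point (through x a≢b x∉d) (through x a≢b (corner∉other-spoke x outer₁ p∈l l≢kx))
          (through y a≢c y∉d) (through y a≢c (corner∉other-spoke y outer₁ p∈l l≢ky)) ¬adl
          (through z b≢c z∉d) (through z b≢c (corner∉other-spoke z outer₂ p∈l l≢kz)) ¬bdl ¬cdl)
    where
    open Triangle t
    through : ∀ {e f g} (v : Corner e f) → e ≢ f → Corner.point v ∉ L g → ¬ Concurrent e f g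
    through v e≢f = ¬Concurrent-through e≢f (Corner.point∈₁ v) (Corner.point∈₂ v)

  outer-line-meets-a-side-on-spoke : ∀ {a b c l d} → Triangle a b c → (x : Corner a b) (y : Corner a c) (z : Corner b c)
    → Spoke l → l ≢ Corner.spoke x → l ≢ Corner.spoke y → l ≢ Corner.spoke z
    → Outer d → a ≢ d → b ≢ d → c ≢ d → Concurrent a d l ⊎ Concurrent b d l ⊎ Concurrent c d l
  outer-line-meets-a-side-on-spoke {a} {b} {c} {l} {d} t x y z p∈l l≢kx l≢ky l≢kz p∉d a≢d b≢d c≢d
    with concurrent? a d l | concurrent? b d l | concurrent? c d l
  ... | yes adl | _       | _       = inj₁ adl
  ... | no _    | yes bdl | _       = inj₂ (inj₁ bdl)
  ... | no _    | no _    | yes cdl = inj₂ (inj₂ cdl)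
  ... | no ¬adl | no ¬bdl | no ¬cdl
    with line-meets-a-corner t x y z p∈l l≢kx l≢ky l≢kz p∉d a≢d b≢d c≢d ¬adl ¬bdl ¬cdl
  ... | inj₁ x∈d = ⊥-elim (¬cdl (line-through-corner-meets-opposite-side (rotate (rotate t)) x (flip y) (flip z)
                                   p∈l l≢kx l≢ky l≢kz p∉d c≢d a≢d b≢d x∈d))
  ... | inj₂ (inj₁ y∈d) = ⊥-elim (¬bdl (line-through-corner-meets-opposite-side (swap t) y (flip x) z
                                   p∈l l≢ky l≢kx l≢kz p∉d b≢d a≢d c≢d y∈d))
  ... | inj₂ (inj₂ z∈d) = ⊥-elim (¬adl (line-through-corner-meets-opposite-side t z x y
                                   p∈l l≢kz l≢kx l≢ky p∉d a≢d b≢d c≢d z∈d))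

  Covers : Subset n → Set
  Covers Q = ∀ e → Outer e → Nonempty (Q ∩ L e)

  covering⇒transversal : ∀ {Q} → Covers Q → IsTransversal S (⁅ p ⁆ ∪ Q)
  covering⇒transversal {Q} covers e with p ∈? L e
  ... | yes p∈e = Nonempty-∩ (x∈p∪q⁺ (inj₁ (x∈⁅x⁆ p))) p∈e
  ... | no  p∉e with q , q∈Q∩e ← covers e p∉e =
    let (q∈Q , q∈e) = x∈p∩q⁻ Q (L e) q∈Q∩e in Nonempty-∩ (x∈p∪q⁺ (inj₂ q∈Q)) q∈e

  concurrent-without-triangles : (∀ a b c → ¬ Triangle a b c) → ∀ {a b c}
    → Outer a → Outer b → Outer c → a ≢ b → a ≢ c → b ≢ c → Concurrent a b c
  concurrent-without-triangles no-triangle {a} {b} {c} p∉a p∉b p∉c a≢b a≢c b≢c with concurrent? a b c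
  ... | yes abc = abc
  ... | no ¬abc = ⊥-elim (no-triangle a b c (record
          { outer₁ = p∉a ; outer₂ = p∉b ; outer₃ = p∉c ; a≢b = a≢b ; a≢c = a≢c ; b≢c = b≢c ; no-common-point = ¬abc }))

  some-point : Fin m → Fin n
  some-point e = proj₁ (nonempty e)

  some-point∈ : ∀ e → some-point e ∈ L e
  some-point∈ e = proj₂ (nonempty e)

  pencil-points : (∀ a b c → ¬ Triangle a b c) → ∃ λ u → ∃ λ v → Covers (⁅ u ⁆ ∪ ⁅ v ⁆)
  pencil-points no-triangle with any? (λ a → ¬? (p ∈? L a))
  ... | no no-outer = p , p , λ e p∉e → ⊥-elim (no-outer (e , p∉e))
  ... | yes (a , p∉a) with any? (λ b → ¬? (p ∈? L b) ×-dec ¬? (b ≟ a))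
  ...   | no only-a = some-point a , some-point a , covers
    where
    covers : Covers (⁅ some-point a ⁆ ∪ ⁅ some-point a ⁆)
    covers e p∉e with e ≟ a
    ... | yes refl = Nonempty-∩ (∈⁅x⁆∪⁅y⁆ (inj₁ refl)) (some-point∈ e)
    ... | no  e≢a  = ⊥-elim (only-a (e , p∉e , e≢a))
  pencil-points no-triangle | yes (a , p∉a) | yes (b , p∉b , b≢a) with any? (λ x → (x ∈? L a) ×-dec (x ∈? L b))
  ...   | yes (x , x∈a , x∈b) = x , x , covers
    where
    covers : Covers (⁅ x ⁆ ∪ ⁅ x ⁆)
    covers e p∉e with e ≟ a | e ≟ b
    ... | yes refl | _        = Nonempty-∩ (∈⁅x⁆∪⁅y⁆ (inj₁ refl)) x∈a
    ... | no  _    | yes refl = Nonempty-∩ (∈⁅x⁆∪⁅y⁆ (inj₁ refl)) x∈b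
    ... | no  e≢a  | no  e≢b
      with q , q∈a , q∈b , q∈e ← concurrent-without-triangles no-triangle p∉a p∉b p∉e (≢-sym b≢a) (≢-sym e≢a) (≢-sym e≢b)
      = Nonempty-∩ (∈⁅x⁆∪⁅y⁆ (inj₁ refl)) (subst (_∈ L e) (lines-meet-once (≢-sym b≢a) q∈a q∈b x∈a x∈b) q∈e)
  ...   | no a∩b≡∅ = some-point a , some-point b , covers
    where
    covers : Covers (⁅ some-point a ⁆ ∪ ⁅ some-point b ⁆)
    covers e p∉e with e ≟ a | e ≟ b
    ... | yes refl | _        = Nonempty-∩ (∈⁅x⁆∪⁅y⁆ (inj₁ refl)) (some-point∈ e)
    ... | no  _    | yes refl = Nonempty-∩ (∈⁅x⁆∪⁅y⁆ (inj₂ refl)) (some-point∈ e)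
    ... | no  e≢a  | no  e≢b
      with q , q∈a , q∈b , _ ← concurrent-without-triangles no-triangle p∉a p∉b p∉e (≢-sym b≢a) (≢-sym e≢a) (≢-sym e≢b)
      = ⊥-elim (a∩b≡∅ (q , q∈a , q∈b))

  pencil-cover : (∀ a b c → ¬ Triangle a b c) → ∃ λ Q → ∣ Q ∣ ≤ 2 × Covers Q
  pencil-cover no-triangle with u , v , covers ← pencil-points no-triangle = ⁅ u ⁆ ∪ ⁅ v ⁆ , ∣⁅x⁆∪⁅y⁆∣≤2 u v , covers

  meeting-point : ∀ {e} l → Outer e → Spoke l → ∃ λ w → w ∈ L e × (∀ {q} → q ∈ L e → q ∈ L l → q ≡ w)
  meeting-point {e} l p∉e p∈l with any? (λ q → (q ∈? L e) ×-dec (q ∈? L l))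
  ... | yes (w , w∈e , w∈l) = w , w∈e , λ q∈e q∈l → lines-meet-once (outer≢spoke p∉e p∈l) q∈e q∈l w∈e w∈l
  ... | no e∩l≡∅ = some-point e , some-point∈ e , λ q∈e q∈l → ⊥-elim (e∩l≡∅ (_ , q∈e , q∈l))

  side-points-cover : ∀ {a b c l wa wb wc} → Triangle a b c → (x : Corner a b) (y : Corner a c) (z : Corner b c)
    → Spoke l → l ≢ Corner.spoke x → l ≢ Corner.spoke y → l ≢ Corner.spoke z
    → wa ∈ L a → wb ∈ L b → wc ∈ L c
    → (∀ {q} → q ∈ L a → q ∈ L l → q ≡ wa) → (∀ {q} → q ∈ L b → q ∈ L l → q ≡ wb) → (∀ {q} → q ∈ L c → q ∈ L l → q ≡ wc)
    → Covers (⁅ wa ⁆ ∪ ⁅ wb ⁆ ∪ ⁅ wc ⁆)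
  side-points-cover {a} {b} {c} t x y z p∈l l≢kx l≢ky l≢kz wa∈a wb∈b wc∈c a∩l≡wa b∩l≡wb c∩l≡wc e p∉e
    with e ≟ a | e ≟ b | e ≟ c
  ... | yes refl | _        | _        = Nonempty-∩ (∈⁅x⁆∪⁅y⁆∪⁅z⁆ (inj₁ refl)) wa∈a
  ... | no _     | yes refl | _        = Nonempty-∩ (∈⁅x⁆∪⁅y⁆∪⁅z⁆ (inj₂ (inj₁ refl))) wb∈b
  ... | no _     | no _     | yes refl = Nonempty-∩ (∈⁅x⁆∪⁅y⁆∪⁅z⁆ (inj₂ (inj₂ refl))) wc∈c
  ... | no e≢a   | no e≢b   | no e≢c
    with outer-line-meets-a-side-on-spoke t x y z p∈l l≢kx l≢ky l≢kz p∉e (≢-sym e≢a) (≢-sym e≢b) (≢-sym e≢c)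
  ... | inj₁ (q , q∈a , q∈e , q∈l)        = Nonempty-∩ (∈⁅x⁆∪⁅y⁆∪⁅z⁆ (inj₁ (a∩l≡wa q∈a q∈l))) q∈e
  ... | inj₂ (inj₁ (q , q∈b , q∈e , q∈l)) = Nonempty-∩ (∈⁅x⁆∪⁅y⁆∪⁅z⁆ (inj₂ (inj₁ (b∩l≡wb q∈b q∈l)))) q∈e
  ... | inj₂ (inj₂ (q , q∈c , q∈e , q∈l)) = Nonempty-∩ (∈⁅x⁆∪⁅y⁆∪⁅z⁆ (inj₂ (inj₂ (c∩l≡wc q∈c q∈l)))) q∈e

  corners-cover : ∀ {a b c} → Triangle a b c → Corner a b → Corner a c → Corner b c → ∃ λ Q → ∣ Q ∣ ≤ 3 × Covers Q
  corners-cover t x y z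
    with l , p∈l , l≢kx , l≢ky , l≢kz ← spoke-avoiding (Corner.spoke x) (Corner.spoke y) (Corner.spoke z)
    with wa , wa∈a , a∩l≡wa ← meeting-point l (Triangle.outer₁ t) p∈l
       | wb , wb∈b , b∩l≡wb ← meeting-point l (Triangle.outer₂ t) p∈l
       | wc , wc∈c , c∩l≡wc ← meeting-point l (Triangle.outer₃ t) p∈l
    = ⁅ wa ⁆ ∪ ⁅ wb ⁆ ∪ ⁅ wc ⁆ , ∣⁅x⁆∪⁅y⁆∪⁅z⁆∣≤3 wa wb wc ,
      side-points-cover t x y z p∈l l≢kx l≢ky l≢kz wa∈a wb∈b wc∈c a∩l≡wa b∩l≡wb c∩l≡wc

  triangle-cover : ∀ {a b c} → Triangle a b c → ∃ λ Q → ∣ Q ∣ ≤ 3 × Covers Q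
  triangle-cover t = corners-cover t (side-corner t) (side-corner (swap (rotate (rotate t)))) (side-corner (rotate t))

  4≤m : 4 ≤ m
  4≤m = ≤-trans (≤-reflexive (sym deg≡4)) (∣p∣≤n spokes)

  7≤m : ∀ {a b c} → Triangle a b c → 7 ≤ m
  7≤m {a} {b} {c} t = ≤-trans (≤-reflexive (sym ∣abc∪spokes∣≡7)) (∣p∣≤n (⁅ a ⁆ ∪ ⁅ b ⁆ ∪ ⁅ c ⁆ ∪ spokes))
    where
    open Triangle t
    ∉spokes : ∀ {e} → Outer e → e ∉ spokes
    ∉spokes p∉e = p∉e ∘ ∈linesThrough⁻
    ∣abc∪spokes∣≡7 : ∣ ⁅ a ⁆ ∪ ⁅ b ⁆ ∪ ⁅ c ⁆ ∪ spokes ∣ ≡ 7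
    ∣abc∪spokes∣≡7 =
      trans (x∉p⇒∣⁅x⁆∪p∣≡1+∣p∣ (x∉⁅y⁆∪p a≢b (x∉⁅y⁆∪p a≢c (∉spokes outer₁)))) (cong suc
      (trans (x∉p⇒∣⁅x⁆∪p∣≡1+∣p∣ (x∉⁅y⁆∪p b≢c (∉spokes outer₂))) (cong suc
      (trans (x∉p⇒∣⁅x⁆∪p∣≡1+∣p∣ (∉spokes outer₃)) (cong suc deg≡4)))))

  small-covering-set : (∃ λ Q → ∣ Q ∣ ≤ 2 × Covers Q) ⊎ (7 ≤ m × ∃ λ Q → ∣ Q ∣ ≤ 3 × Covers Q)
  small-covering-set with any? (λ a → any? (λ b → any? (λ c → triangle? a b c)))
  ... | yes (a , b , c , t) = inj₂ (7≤m t , triangle-cover t)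
  ... | no no-triangle      = inj₁ (pencil-cover λ a b c t → no-triangle (a , b , c , t))

  4r+1≤n+4 : ∀ {r} → Uniform r S → 4 * r + 1 ≤ n + 4
  4r+1≤n+4 uniform = lines-through-bound uniform p (≤-reflexive (sym deg≡4))

  bounded-transversal : ∀ {r} → 2 ≤ r → Uniform r S → ∃ λ T → IsTransversal S T × ∣ T ∣ * suc r ≤ n + m
  bounded-transversal {r} 2≤r uniform with small-covering-set
  ... | inj₁ (Q , ∣Q∣≤2 , covers) = ⁅ p ⁆ ∪ Q , covering⇒transversal covers ,
    ≤-trans (*-monoˡ-≤ (suc r) (≤-trans (∣⁅x⁆∪p∣≤1+∣p∣ p Q) (s≤s ∣Q∣≤2))) (3*[1+r]≤n+m 2≤r (4r+1≤n+4 uniform) 4≤m)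
  ... | inj₂ (7≤m , Q , ∣Q∣≤3 , covers) = ⁅ p ⁆ ∪ Q , covering⇒transversal covers ,
    ≤-trans (*-monoˡ-≤ (suc r) (≤-trans (∣⁅x⁆∪p∣≤1+∣p∣ p Q) (s≤s ∣Q∣≤3))) (4*[1+r]≤n+m (4r+1≤n+4 uniform) 7≤m)

corollary2p19 : ∀ (n m r : ℕ) (S : LinearSystem n m) → 2 ≤ r → Uniform r S
                → Nu2 S 4 → MaxDegree S 4
                → ∃ λ (T : Subset n) → IsTransversal S T × ∣ T ∣ * suc r ≤ n + m
corollary2p19 n m r S 2≤r uniform (_ , ν₂≤4) (_ , p , deg≡4) =
  Centred.bounded-transversal S ν₂≤4 p deg≡4 nonempty 2≤r uniform
  where
  nonempty : ∀ e → Nonempty (line S e)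
  nonempty e = 0<∣p∣⇒Nonempty (line S e) (subst (0 <_) (sym (uniform e)) (≤-trans (s≤s z≤n) 2≤r))
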